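{- Let $k\ge 2$ and $\delta=\frac{k+\lfloor k/3\rfloor}{2k}$. The deterministic online algorithm ARGBA (defined in the context) is $1/\delta$-competitive for $k$S2L-F: for every instance, the number of requests accepted by ARGBA is at least $\delta$ times the optimal offline profit OPT.
   Context: Problem $k$S2L (car sharing with two locations). There are two locations $0$ and $1$ and $k$ servers. Time is divided into stages $i=1,2,3,\dots$. A request of a stage is either a "(0,1)" (pick up at location 0, drop off at location 1) or a "(1,0)" (pick up at 1, drop off at 0). Each server serves at most one request per stage; a server that serves a (0,1) in stage $i$ can only be used for a (1,0) (or left unused) in stage $i+1$, and symmetrically; a server unused in stage $i$ may be moved for free and used in stage $i+1$ for either direction. Before stage 1 all servers count as unused. Formally, if $\ell_i,r_i$ are the numbers of accepted (0,1)'s and (1,0)'s in stage $i$ and $f_i=k-\ell_i-r_i$, with $\ell_0=r_0=0$, $f_0=k$, a choice is feasible iff for all $i\ge1$: $\ell_i$ (resp. $r_i$) is at most the number of (0,1) (resp. (1,0)) requests of stage $i$, $\ell_i\le r_{i-1}+f_{i-1}$, $r_i\le \ell_{i-1}+f_{i-1}$, and $\ell_i+r_i\le k$. The profit is the total number of accepted requests; OPT is the maximum feasible profit of the (finite) instance. In the model $k$S2L-F, the requests of each stage arrive one at a time (the algorithm does not know how many will arrive), and each must be irrevocably accepted or rejected immediately upon arrival, before the next one arrives. An online algorithm is $1/\delta$-competitive ($0<\delta\le1$) if on every instance its profit (expected profit, for randomized algorithms) is at least $\delta\cdot$OPT. Algorithm ARGBA. Let $G\ell_0=Gr_0=0$.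 In stage $i$, let $Gf_{i-1}=k-G\ell_{i-1}-Gr_{i-1}$, where $G\ell_{i-1},Gr_{i-1}$ are the numbers of (0,1)'s and (1,0)'s accepted in stage $i-1$. During stage $i$ maintain $G\ell_i,Gr_i$ (numbers accepted so far in stage $i$, initially 0). When a (0,1) arrives, let $a$ be the number of (0,1)'s of stage $i$ that arrived before it; accept it (and increase $G\ell_i$) iff $a<Gr_{i-1}+Gf_{i-1}$, $a<2k/3$ and $G\ell_i+Gr_i<k$; otherwise reject. When a (1,0) arrives, let $b$ be the number of (1,0)'s of stage $i$ that arrived before it; accept it (and increase $Gr_i$) iff $b<G\ell_{i-1}+Gf_{i-1}$, $b<2k/3$ and $G\ell_i+Gr_i<k$; otherwise reject. -}

module Defs where

open import Data.Nat using (ℕ; zero; suc; _+_; _*_; _∸_; _≤_; _<ᵇ_)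
open import Data.Bool using (Bool; true; false; _∧_; if_then_else_)
open import Data.List using (List; []; _∷_)
open import Data.Product using (_×_; _,_)

-- A request: LR = "(0,1)" (pick up at 0, drop at 1), RL = "(1,0)".
data Req : Set where
  LR RL : Req

-- An instance: list of stages; each stage is the list of its requests
-- in arrival order.
Instance : Set
Instance = List (List Req)

countLR : List Req → ℕ
countLR []        = 0
countLR (LR ∷ xs) = suc (countLR xs)
countLR (RL ∷ xs) = countLR xs

countRL : List Req → ℕ
countRL []        = 0
countRL (RL ∷ xs) = suc (countRL xs)
countRL (LR ∷ xs) = countRL xs

-- Feasible k ℓprev rprev stages choices : the choice (ℓ_i , r_i) per stage
-- is feasible, given the previous stage accepted ℓprev, rprev
-- (so f_{i-1} = k ∸ ℓprev ∸ rprev).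
data Feasible (k : ℕ) : ℕ → ℕ → Instance → List (ℕ × ℕ) → Set where
  done : ∀ {lp rp} → Feasible k lp rp [] []
  step : ∀ {lp rp s ss l r cs} →
         l ≤ countLR s →
         r ≤ countRL s →
         l ≤ rp + (k ∸ lp ∸ rp) →
         r ≤ lp + (k ∸ lp ∸ rp) →
         l + r ≤ k →
         Feasible k l r ss cs →
         Feasible k lp rp (s ∷ ss) ((l , r) ∷ cs)

profit : List (ℕ × ℕ) → ℕ
profit []             = 0
profit ((l , r) ∷ cs) = l + r + profit cs

-- Arguments: k, Gℓ_{i-1}, Gr_{i-1}, a (# LR arrived so far in stage),
-- b (# RL arrived so far), Gℓ_i, Gr_i (accepted so far), remaining requests.
-- The condition a < 2k/3 is encoded as 3a < 2k.
argbaStage : ℕ → ℕ → ℕ → ℕ → ℕ → ℕ → ℕ → List Req → ℕ × ℕ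
argbaStage k lp rp a b gl gr [] = gl , gr
argbaStage k lp rp a b gl gr (LR ∷ xs) =
  if (a <ᵇ rp + (k ∸ lp ∸ rp)) ∧ (3 * a <ᵇ 2 * k) ∧ (gl + gr <ᵇ k)
  then argbaStage k lp rp (suc a) b (suc gl) gr xs
  else argbaStage k lp rp (suc a) b gl gr xs
argbaStage k lp rp a b gl gr (RL ∷ xs) =
  if (b <ᵇ lp + (k ∸ lp ∸ rp)) ∧ (3 * b <ᵇ 2 * k) ∧ (gl + gr <ᵇ k)
  then argbaStage k lp rp a (suc b) gl (suc gr) xs
  else argbaStage k lp rp a (suc b) gl gr xs

argbaFrom : ℕ → ℕ → ℕ → Instance → ℕ
argbaFrom k lp rp [] = 0
argbaFrom k lp rp (s ∷ ss) with argbaStage k lp rp 0 0 0 0 s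
... | gl , gr = gl + gr + argbaFrom k gl gr ss

argba : ℕ → Instance → ℕ
argba k inst = argbaFrom k 0 0 inst

-- Let t = ⌈2k/3⌉ be ARGBA's per-direction threshold and c = k + ⌊k/3⌋,
-- so that c + t = 2k. For ARGBA's count g and OPT's count o of one direction in the previous
-- stage put Φ g o = max (c o) (2k g − k t). Stage by stage, c · (OPT's acceptances) plus the
-- new potential is paid for by 2k · (ARGBA's acceptances) plus the old potential. This works
-- because in every direction ARGBA either accepted whatever OPT could accept, or ran out of
-- servers (which were then busy in the other direction: k ≤ g + g_prev), or hit the threshold
-- t; and otherwise all k servers were used. The constants enter through c ≤ 2k, c k ≤ 2k t
-- and c k + k t = 2k k.
module Submission where

open import Defs
open import Data.Nat using (ℕ; _+_; _*_; _≤_; _/_)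
open import Data.List using (List)
open import Data.Product using (_×_)

open import Data.Bool using (Bool; true; false; _∧_)
open import Data.List using ([]; _∷_)
open import Data.Nat using (suc; _∸_; _<_; _<ᵇ_; _⊔_; _%_; z≤n; s≤s)
open import Data.Nat.DivMod using (m≡m%n+[m/n]*n; m%n<n; m/n≤m)
open import Data.Nat.Properties
open import Data.Nat.Tactic.RingSolver using (solve-∀)
open import Data.Product using (_,_; uncurry; map₁; map₂)
open import Data.Sum using (_⊎_; inj₁; inj₂) renaming (map to ⊎-map; map₂ to ⊎-map₂)
open import Relation.Binary.PropositionalEquality
  using (_≡_; refl; sym; trans; cong; subst; module ≡-Reasoning)
open import Relation.Nullary using (¬_)
open import Relation.Nullary.Reflects using (ofʸ; ofⁿ)

+-⊔-lub : ∀ {m n o p q} → m + o ≤ q → m + p ≤ q → n + o ≤ q → n + p ≤ q →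
          (m ⊔ n) + (o ⊔ p) ≤ q
+-⊔-lub {m} {n} {o} {p} mo mp no np
  rewrite +-distribʳ-⊔ (o ⊔ p) m n | +-distribˡ-⊔ m o p | +-distribˡ-⊔ n o p =
  ⊔-lub (⊔-lub mo mp) (⊔-lub no np)

m+n≤o+p⇒m≤o+[p∸n] : ∀ m n o p → m + n ≤ o + p → m ≤ o + (p ∸ n)
m+n≤o+p⇒m≤o+[p∸n] m n o p m+n≤o+p = +-cancelʳ-≤ n m (o + (p ∸ n)) (begin
  m + n             ≤⟨ m+n≤o+p ⟩
  o + p             ≤⟨ +-monoʳ-≤ o (m≤n+m∸n p n) ⟩
  o + (n + (p ∸ n)) ≡⟨ cong (o +_) (+-comm n (p ∸ n)) ⟩
  o + ((p ∸ n) + n) ≡⟨ +-assoc o (p ∸ n) n ⟨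
  o + (p ∸ n) + n   ∎)
  where open ≤-Reasoning

∸-swap : ∀ m n o → m ∸ n ∸ o ≡ m ∸ o ∸ n
∸-swap m n o =
  trans (∸-+-assoc m n o) (trans (cong (m ∸_) (+-comm n o)) (sym (∸-+-assoc m o n)))

y+[k∸x∸y]≡k∸x : ∀ {k x y} → x + y ≤ k → y + (k ∸ x ∸ y) ≡ k ∸ x
y+[k∸x∸y]≡k∸x {k} {x} {y} x+y≤k =
  m+[n∸m]≡n (m+n≤o⇒m≤o∸n y (subst (_≤ k) (+-comm x y) x+y≤k))

feasible-LR : ∀ {k l l' r'} → l' + r' ≤ k → l ≤ r' + (k ∸ l' ∸ r') → l + l' ≤ k
feasible-LR {k} {l} {l'} {r'} l'+r'≤k l≤cap =
  m≤o∸n⇒m+n≤o l (m+n≤o⇒m≤o l' l'+r'≤k)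
    (subst (l ≤_) (y+[k∸x∸y]≡k∸x {k} {l'} {r'} l'+r'≤k) l≤cap)

feasible-RL : ∀ {k r l' r'} → l' + r' ≤ k → r ≤ l' + (k ∸ l' ∸ r') → r + r' ≤ k
feasible-RL {k} {r} {l'} {r'} l'+r'≤k r≤cap =
  feasible-LR (subst (_≤ k) (+-comm l' r') l'+r'≤k)
              (subst (λ z → r ≤ l' + z) (∸-swap k l' r') r≤cap)

-- Of the first n requests of one direction, g were accepted, and every rejection among them
-- is explained by the capacity cap or the threshold t.
Saturated : (t n cap g : ℕ) → Set
Saturated t n cap g = n ≤ g ⊎ cap ≤ g ⊎ t ≤ g

Saturated-mono : ∀ {t n n' cap cap' g} → n' ≤ n → cap' ≤ cap →
                 Saturated t n cap g → Saturated t n' cap' g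
Saturated-mono n'≤n _        (inj₁ n≤g)          = inj₁ (≤-trans n'≤n n≤g)
Saturated-mono _    cap'≤cap (inj₂ (inj₁ cap≤g)) = inj₂ (inj₁ (≤-trans cap'≤cap cap≤g))
Saturated-mono _    _        (inj₂ (inj₂ t≤g))   = inj₂ (inj₂ t≤g)

Saturated-accept : ∀ {t n cap g} → Saturated t n cap g → Saturated t (suc n) cap (suc g)
Saturated-accept (inj₁ n≤g)          = inj₁ (s≤s n≤g)
Saturated-accept (inj₂ (inj₁ cap≤g)) = inj₂ (inj₁ (m≤n⇒m≤1+n cap≤g))
Saturated-accept (inj₂ (inj₂ t≤g))   = inj₂ (inj₂ (m≤n⇒m≤1+n t≤g))

Saturated-reject : ∀ {t n cap g} → cap ≤ n ⊎ t ≤ n →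
                   Saturated t n cap g → Saturated t (suc n) cap g
Saturated-reject (inj₁ cap≤n) (inj₁ n≤g) = inj₂ (inj₁ (≤-trans cap≤n n≤g))
Saturated-reject (inj₂ t≤n)   (inj₁ n≤g) = inj₂ (inj₂ (≤-trans t≤n n≤g))
Saturated-reject _            (inj₂ sat) = inj₂ sat

Justified : (t k nL capL nR capR gl gr : ℕ) → Set
Justified t k nL capL nR capR gl gr =
  k ≤ gl + gr ⊎ (Saturated t nL capL gl × Saturated t nR capR gr)

Justified-mono : ∀ {t k nL nL' capL capL' nR nR' capR capR' gl gr} →
                 nL' ≤ nL → capL' ≤ capL → nR' ≤ nR → capR' ≤ capR →
                 Justified t k nL capL nR capR gl gr → Justified t k nL' capL' nR' capR' gl gr
Justified-mono _   _     _   _     (inj₁ full)          = inj₁ full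
Justified-mono nL capL nR capR (inj₂ (satL , satR)) =
  inj₂ (Saturated-mono nL capL satL , Saturated-mono nR capR satR)

-- t is ⌈2k/3⌉, which is characterised by 2k ≤ 3t ≤ 2k + 2; ARGBA's test 3a < 2k is a < t.
module Threshold (k t : ℕ) (2k≤3t : 2 * k ≤ 3 * t) (3t≤2+2k : 3 * t ≤ 2 + 2 * k) where

  under-threshold : ∀ {a} → 3 * a < 2 * k → a < t
  under-threshold {a} 3a<2k = *-cancelˡ-< 3 a t (<-≤-trans 3a<2k 2k≤3t)

  over-threshold : ∀ {a} → ¬ 3 * a < 2 * k → t ≤ a
  over-threshold {a} 3a≮2k = ≤-pred (*-cancelˡ-< 3 t (suc a) (begin-strict
    3 * t     ≤⟨ 3t≤2+2k ⟩
    2 + 2 * k ≤⟨ +-monoʳ-≤ 2 (≮⇒≥ 3a≮2k) ⟩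
    2 + 3 * a <⟨ n<1+n (2 + 3 * a) ⟩
    3 + 3 * a ≡⟨ *-suc 3 a ⟨
    3 * suc a ∎))
    where open ≤-Reasoning

  t≤k : t ≤ k
  t≤k = over-threshold (≤⇒≯ (*-monoˡ-≤ k (n≤1+n 2)))

  data Verdict (a cap s : ℕ) : Bool → Set where
    accept : a < t → Verdict a cap s true
    reject : (cap ≤ a ⊎ t ≤ a) ⊎ k ≤ s → Verdict a cap s false

  verdict : ∀ a cap s → Verdict a cap s ((a <ᵇ cap) ∧ (3 * a <ᵇ 2 * k) ∧ (s <ᵇ k))
  verdict a cap s with a <ᵇ cap | <ᵇ-reflects-< a cap
  ... | false | ofⁿ a≮cap = reject (inj₁ (inj₁ (≮⇒≥ a≮cap)))
  ... | true  | ofʸ _ with 3 * a <ᵇ 2 * k | <ᵇ-reflects-< (3 * a) (2 * k)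
  ...   | false | ofⁿ 3a≮2k = reject (inj₁ (inj₂ (over-threshold 3a≮2k)))
  ...   | true  | ofʸ 3a<2k with s <ᵇ k | <ᵇ-reflects-< s k
  ...     | false | ofⁿ s≮k = reject (inj₂ (≮⇒≥ s≮k))
  ...     | true  | ofʸ _   = accept (under-threshold 3a<2k)

  record Invariant (capL capR a b gl gr : ℕ) : Set where
    field
      gl≤a      : gl ≤ a
      gr≤b      : gr ≤ b
      gl≤t      : gl ≤ t
      gr≤t      : gr ≤ t
      justified : Justified t k a capL b capR gl gr

  initial : ∀ {capL capR} → Invariant capL capR 0 0 0 0
  initial = record { gl≤a = z≤n ; gr≤b = z≤n ; gl≤t = z≤n ; gr≤t = z≤n
                   ; justified = inj₂ (inj₁ z≤n , inj₁ z≤n) }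

  module _ {capL capR a b gl gr : ℕ} (inv : Invariant capL capR a b gl gr) where
    open Invariant inv

    accept-LR : a < t → Invariant capL capR (suc a) b (suc gl) gr
    accept-LR a<t = record
      { gl≤a = s≤s gl≤a ; gr≤b = gr≤b ; gl≤t = ≤-<-trans gl≤a a<t ; gr≤t = gr≤t
      ; justified = ⊎-map m≤n⇒m≤1+n (map₁ Saturated-accept) justified }

    accept-RL : b < t → Invariant capL capR a (suc b) gl (suc gr)
    accept-RL b<t = record
      { gl≤a = gl≤a ; gr≤b = s≤s gr≤b ; gl≤t = gl≤t ; gr≤t = ≤-<-trans gr≤b b<t
      ; justified = ⊎-map (λ full → subst (k ≤_) (sym (+-suc gl gr)) (m≤n⇒m≤1+n full))
                          (map₂ Saturated-accept) justified }

    reject-LR : (capL ≤ a ⊎ t ≤ a) ⊎ k ≤ gl + gr → Invariant capL capR (suc a) b gl gr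
    reject-LR why = record
      { gl≤a = m≤n⇒m≤1+n gl≤a ; gr≤b = gr≤b ; gl≤t = gl≤t ; gr≤t = gr≤t
      ; justified = justified′ why }
      where
      justified′ : (capL ≤ a ⊎ t ≤ a) ⊎ k ≤ gl + gr → Justified t k (suc a) capL b capR gl gr
      justified′ (inj₁ forced) = ⊎-map₂ (map₁ (Saturated-reject forced)) justified
      justified′ (inj₂ full)   = inj₁ full

    reject-RL : (capR ≤ b ⊎ t ≤ b) ⊎ k ≤ gl + gr → Invariant capL capR a (suc b) gl gr
    reject-RL why = record
      { gl≤a = gl≤a ; gr≤b = m≤n⇒m≤1+n gr≤b ; gl≤t = gl≤t ; gr≤t = gr≤t
      ; justified = justified′ why }
      where
      justified′ : (capR ≤ b ⊎ t ≤ b) ⊎ k ≤ gl + gr → Justified t k a capL (suc b) capR gl gr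
      justified′ (inj₁ forced) = ⊎-map₂ (map₂ (Saturated-reject forced)) justified
      justified′ (inj₂ full)   = inj₁ full

  capLR capRL : ℕ → ℕ → ℕ
  capLR lp rp = rp + (k ∸ lp ∸ rp)
  capRL lp rp = lp + (k ∸ lp ∸ rp)

  argbaStage-invariant : ∀ lp rp a b gl gr xs →
    Invariant (capLR lp rp) (capRL lp rp) a b gl gr →
    uncurry (Invariant (capLR lp rp) (capRL lp rp) (a + countLR xs) (b + countRL xs))
            (argbaStage k lp rp a b gl gr xs)
  argbaStage-invariant lp rp a b gl gr [] inv
    rewrite +-identityʳ a | +-identityʳ b = inv
  argbaStage-invariant lp rp a b gl gr (LR ∷ xs) inv
    rewrite +-suc a (countLR xs)
    with (a <ᵇ capLR lp rp) ∧ (3 * a <ᵇ 2 * k) ∧ (gl + gr <ᵇ k)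
       | verdict a (capLR lp rp) (gl + gr)
  ... | true  | accept a<t = argbaStage-invariant lp rp (suc a) b (suc gl) gr xs (accept-LR inv a<t)
  ... | false | reject why = argbaStage-invariant lp rp (suc a) b gl gr xs (reject-LR inv why)
  argbaStage-invariant lp rp a b gl gr (RL ∷ xs) inv
    rewrite +-suc b (countRL xs)
    with (b <ᵇ capRL lp rp) ∧ (3 * b <ᵇ 2 * k) ∧ (gl + gr <ᵇ k)
       | verdict b (capRL lp rp) (gl + gr)
  ... | true  | accept b<t = argbaStage-invariant lp rp a (suc b) gl (suc gr) xs (accept-RL inv b<t)
  ... | false | reject why = argbaStage-invariant lp rp a (suc b) gl gr xs (reject-RL inv why)

module Potential (k t c : ℕ) (c+t≡2k : c + t ≡ 2 * k) (t≤k : t ≤ k) (2k≤3t : 2 * k ≤ 3 * t)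
  where

  Φ : ℕ → ℕ → ℕ
  Φ g o = c * o ⊔ (2 * k * g ∸ k * t)

  c≤2k : c ≤ 2 * k
  c≤2k = m+n≤o⇒m≤o c (≤-reflexive c+t≡2k)

  c≤2t : c ≤ 2 * t
  c≤2t = +-cancelʳ-≤ t c (2 * t)
    (≤-trans (≤-reflexive c+t≡2k) (≤-trans 2k≤3t (≤-reflexive (+-comm t (2 * t)))))

  t≤c : t ≤ c
  t≤c = +-cancelʳ-≤ t t c (≤-trans (+-mono-≤ t≤k t≤k)
    (≤-reflexive (trans (cong (k +_) (sym (+-identityʳ k))) (sym c+t≡2k))))

  c*k+k*t≡2*k*k : c * k + k * t ≡ 2 * k * k
  c*k+k*t≡2*k*k = begin
    c * k + k * t ≡⟨ cong (c * k +_) (*-comm k t) ⟩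
    c * k + t * k ≡⟨ *-distribʳ-+ k c t ⟨
    (c + t) * k   ≡⟨ cong (_* k) c+t≡2k ⟩
    2 * k * k     ∎
    where open ≡-Reasoning

  c*k≤2*k*t : c * k ≤ 2 * k * t
  c*k≤2*k*t = ≤-trans (*-monoˡ-≤ k c≤2t) (≤-reflexive (reorder k t))
    where
    reorder : ∀ k t → 2 * t * k ≡ 2 * k * t
    reorder = solve-∀

  k*t≤c*k : k * t ≤ c * k
  k*t≤c*k = ≤-trans (*-monoʳ-≤ k t≤c) (≤-reflexive (*-comm k c))

  2*k*g∸k*t≤k*t : ∀ {g} → g ≤ t → 2 * k * g ∸ k * t ≤ k * t
  2*k*g∸k*t≤k*t {g} g≤t = m≤n+o⇒m∸n≤o (2 * k * g) (k * t)
    (≤-trans (*-monoʳ-≤ (2 * k) g≤t) (≤-reflexive (double k t)))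
    where
    double : ∀ k t → 2 * k * t ≡ k * t + k * t
    double = solve-∀

  c*[l+r]≤Φ+Φ : ∀ gl gr l r → c * (l + r) ≤ Φ gl l + Φ gr r
  c*[l+r]≤Φ+Φ gl gr l r =
    ≤-trans (≤-reflexive (*-distribˡ-+ c l r)) (+-mono-≤ (m≤m⊔n (c * l) _) (m≤m⊔n (c * r) _))

  Φ-full : ∀ {l r gl gr} → l + r ≤ k → gl ≤ t → gr ≤ t → Φ gl l + Φ gr r ≤ 2 * k * k
  Φ-full {l} {r} {gl} {gr} l+r≤k gl≤t gr≤t =
    ≤-trans (+-⊔-lub {c * l} {2 * k * gl ∸ k * t} {c * r} opt-opt opt-alg alg-opt alg-alg)
            (≤-reflexive c*k+k*t≡2*k*k)
    where
    l≤k : l ≤ k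
    l≤k = m+n≤o⇒m≤o l l+r≤k
    r≤k : r ≤ k
    r≤k = m+n≤o⇒n≤o l l+r≤k
    opt-opt : c * l + c * r ≤ c * k + k * t
    opt-opt = ≤-trans (≤-reflexive (sym (*-distribˡ-+ c l r)))
                      (≤-trans (*-monoʳ-≤ c l+r≤k) (m≤m+n (c * k) (k * t)))
    opt-alg : c * l + (2 * k * gr ∸ k * t) ≤ c * k + k * t
    opt-alg = +-mono-≤ (*-monoʳ-≤ c l≤k) (2*k*g∸k*t≤k*t gr≤t)
    alg-opt : (2 * k * gl ∸ k * t) + c * r ≤ c * k + k * t
    alg-opt = ≤-trans (+-mono-≤ (2*k*g∸k*t≤k*t gl≤t) (*-monoʳ-≤ c r≤k))
                      (≤-reflexive (+-comm (k * t) (c * k)))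
    alg-alg : (2 * k * gl ∸ k * t) + (2 * k * gr ∸ k * t) ≤ c * k + k * t
    alg-alg = +-mono-≤ (≤-trans (2*k*g∸k*t≤k*t gl≤t) k*t≤c*k) (2*k*g∸k*t≤k*t gr≤t)

  Φ-direction : ∀ {l l' g A} → l + l' ≤ k → Saturated t l (k ∸ A) g →
                Φ g l + c * l' ≤ 2 * k * g + Φ A l'
  Φ-direction {l} {l'} {g} {A} l+l'≤k sat
    rewrite +-distribʳ-⊔ (c * l') (c * l) (2 * k * g ∸ k * t) =
    ⊔-lub (opt sat) (+-mono-≤ (m∸n≤m (2 * k * g) (k * t)) (m≤m⊔n (c * l') _))
    where
    open ≤-Reasoning
    opt : Saturated t l (k ∸ A) g → c * l + c * l' ≤ 2 * k * g + Φ A l'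
    opt (inj₁ l≤g) = +-mono-≤ (*-mono-≤ c≤2k l≤g) (m≤m⊔n (c * l') _)
    opt (inj₂ (inj₂ t≤g)) = begin
      c * l + c * l'     ≡⟨ *-distribˡ-+ c l l' ⟨
      c * (l + l')       ≤⟨ *-monoʳ-≤ c l+l'≤k ⟩
      c * k              ≤⟨ c*k≤2*k*t ⟩
      2 * k * t          ≤⟨ *-monoʳ-≤ (2 * k) t≤g ⟩
      2 * k * g          ≤⟨ m≤m+n (2 * k * g) (Φ A l') ⟩
      2 * k * g + Φ A l' ∎
    opt (inj₂ (inj₁ k∸A≤g)) = begin
      c * l + c * l'                  ≡⟨ *-distribˡ-+ c l l' ⟨
      c * (l + l')                    ≤⟨ m+n≤o+p⇒m≤o+[p∸n] _ (k * t) (2 * k * g) _ budget ⟩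
      2 * k * g + (2 * k * A ∸ k * t) ≤⟨ +-monoʳ-≤ (2 * k * g) (m≤n⊔m (c * l') _) ⟩
      2 * k * g + Φ A l'              ∎
      where
      k≤g+A : k ≤ g + A
      k≤g+A = ≤-trans (m≤n+m∸n k A) (≤-trans (+-monoʳ-≤ A k∸A≤g) (≤-reflexive (+-comm A g)))
      budget : c * (l + l') + k * t ≤ 2 * k * g + 2 * k * A
      budget = begin
        c * (l + l') + k * t  ≤⟨ +-monoˡ-≤ (k * t) (*-monoʳ-≤ c l+l'≤k) ⟩
        c * k + k * t         ≡⟨ c*k+k*t≡2*k*k ⟩
        2 * k * k             ≤⟨ *-monoʳ-≤ (2 * k) k≤g+A ⟩
        2 * k * (g + A)       ≡⟨ *-distribˡ-+ (2 * k) g A ⟩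
        2 * k * g + 2 * k * A ∎

  Φ-stage : ∀ {l r l' r' gl gr lp rp} →
            l + r ≤ k → l + l' ≤ k → r + r' ≤ k → gl ≤ t → gr ≤ t →
            Justified t k l (k ∸ lp) r (k ∸ rp) gl gr →
            Φ gl l + Φ gr r + c * (l' + r') ≤ 2 * k * (gl + gr) + (Φ lp l' + Φ rp r')
  Φ-stage {l' = l'} {r'} {lp = lp} {rp} l+r≤k _ _ gl≤t gr≤t (inj₁ full) =
    +-mono-≤ (≤-trans (Φ-full l+r≤k gl≤t gr≤t) (*-monoʳ-≤ (2 * k) full)) (c*[l+r]≤Φ+Φ lp rp l' r')
  Φ-stage {l} {r} {l'} {r'} {gl} {gr} {lp} {rp} _ l+l'≤k r+r'≤k _ _ (inj₂ (satL , satR)) = begin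
    Φ gl l + Φ gr r + c * (l' + r')                 ≡⟨ regroup (Φ gl l) (Φ gr r) c l' r' ⟩
    (Φ gl l + c * l') + (Φ gr r + c * r')           ≤⟨ +-mono-≤ (Φ-direction l+l'≤k satL)
                                                                 (Φ-direction r+r'≤k satR) ⟩
    (2 * k * gl + Φ lp l') + (2 * k * gr + Φ rp r') ≡⟨ collect (2 * k) gl gr (Φ lp l') (Φ rp r') ⟩
    2 * k * (gl + gr) + (Φ lp l' + Φ rp r')         ∎
    where
    open ≤-Reasoning
    regroup : ∀ x y c l' r' → x + y + c * (l' + r') ≡ (x + c * l') + (y + c * r')
    regroup = solve-∀
    collect : ∀ m a b x y → (m * a + x) + (m * b + y) ≡ m * (a + b) + (x + y)
    collect = solve-∀

module Competitive (k t c : ℕ) (c+t≡2k : c + t ≡ 2 * k)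
                   (2k≤3t : 2 * k ≤ 3 * t) (3t≤2+2k : 3 * t ≤ 2 + 2 * k) where

  open Threshold k t 2k≤3t 3t≤2+2k
  open Potential k t c c+t≡2k t≤k 2k≤3t

  argbaFrom-bound : ∀ {lp rp l' r' inst cs} → l' + r' ≤ k → Feasible k l' r' inst cs →
    c * (l' + r') + c * profit cs ≤ 2 * k * argbaFrom k lp rp inst + (Φ lp l' + Φ rp r')
  argbaFrom-bound {lp} {rp} {l'} {r'} _ done
    rewrite *-zeroʳ c | *-zeroʳ (2 * k) | +-identityʳ (c * (l' + r')) = c*[l+r]≤Φ+Φ lp rp l' r'
  argbaFrom-bound {lp} {rp} {l'} {r'} l'+r'≤k
                  (step {s = s} {ss} {l} {r} {cs} l≤#LR r≤#RL l≤capLR r≤capRL l+r≤k feasible)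
    with argbaStage k lp rp 0 0 0 0 s | argbaStage-invariant lp rp 0 0 0 0 s initial
  ... | gl , gr | inv = begin
    c * (l' + r') + c * (l + r + profit cs)
      ≡⟨ cong (c * (l' + r') +_) (*-distribˡ-+ c (l + r) (profit cs)) ⟩
    c * (l' + r') + (c * (l + r) + c * profit cs)
      ≤⟨ +-monoʳ-≤ (c * (l' + r')) (argbaFrom-bound l+r≤k feasible) ⟩
    c * (l' + r') + (2 * k * rest + (Φ gl l + Φ gr r))
      ≡⟨ regroup (c * (l' + r')) (2 * k * rest) (Φ gl l + Φ gr r) ⟩
    (Φ gl l + Φ gr r + c * (l' + r')) + 2 * k * rest
      ≤⟨ +-monoˡ-≤ (2 * k * rest) stage ⟩
    (2 * k * (gl + gr) + (Φ lp l' + Φ rp r')) + 2 * k * rest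
      ≡⟨ collect (2 * k) (gl + gr) rest (Φ lp l' + Φ rp r') ⟩
    2 * k * (gl + gr + rest) + (Φ lp l' + Φ rp r')
      ∎
    where
    open ≤-Reasoning
    open Invariant inv
    rest : ℕ
    rest = argbaFrom k gl gr ss
    k∸rp≤capRL : k ∸ rp ≤ capRL lp rp
    k∸rp≤capRL = subst (λ z → k ∸ rp ≤ lp + z) (∸-swap k rp lp) (m≤n+m∸n (k ∸ rp) lp)
    stage : Φ gl l + Φ gr r + c * (l' + r') ≤ 2 * k * (gl + gr) + (Φ lp l' + Φ rp r')
    stage = Φ-stage l+r≤k (feasible-LR l'+r'≤k l≤capLR) (feasible-RL l'+r'≤k r≤capRL) gl≤t gr≤t
      (Justified-mono l≤#LR (m≤n+m∸n (k ∸ lp) rp) r≤#RL k∸rp≤capRL justified)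
    regroup : ∀ a b x → a + (b + x) ≡ x + a + b
    regroup = solve-∀
    collect : ∀ m g n x → m * g + x + m * n ≡ m * (g + n) + x
    collect = solve-∀

  argba-competitive : ∀ {inst cs} → Feasible k 0 0 inst cs → c * profit cs ≤ 2 * k * argba k inst
  argba-competitive {inst} {cs} feasible = begin
    c * profit cs                          ≡⟨ cong (_+ c * profit cs) (*-zeroʳ c) ⟨
    c * (0 + 0) + c * profit cs            ≤⟨ argbaFrom-bound z≤n feasible ⟩
    2 * k * argba k inst + (Φ 0 0 + Φ 0 0) ≡⟨ cong (λ φ → 2 * k * argba k inst + (φ + φ)) Φ-0-0 ⟩
    2 * k * argba k inst + 0               ≡⟨ +-identityʳ (2 * k * argba k inst) ⟩
    2 * k * argba k inst                   ∎
    where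
    open ≤-Reasoning
    Φ-0-0 : Φ 0 0 ≡ 0
    Φ-0-0 rewrite *-zeroʳ c | *-zeroʳ (2 * k) | 0∸n≡0 (k * t) = refl

3*[n∸n/3]≡n%3+2*n : ∀ n → 3 * (n ∸ n / 3) ≡ n % 3 + 2 * n
3*[n∸n/3]≡n%3+2*n n = begin
  3 * (n ∸ n / 3)                           ≡⟨ *-distribˡ-∸ 3 n (n / 3) ⟩
  3 * n ∸ 3 * (n / 3)                       ≡⟨ cong (λ m → m + 2 * n ∸ 3 * (n / 3)) (m≡m%n+[m/n]*n n 3) ⟩
  n % 3 + n / 3 * 3 + 2 * n ∸ 3 * (n / 3)   ≡⟨ cong (_∸ 3 * (n / 3)) (reorder (n % 3) (n / 3) n) ⟩
  n % 3 + 2 * n + 3 * (n / 3) ∸ 3 * (n / 3) ≡⟨ m+n∸n≡m (n % 3 + 2 * n) (3 * (n / 3)) ⟩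
  n % 3 + 2 * n                             ∎
  where
  open ≡-Reasoning
  reorder : ∀ ρ q n → ρ + q * 3 + 2 * n ≡ ρ + 2 * n + 3 * q
  reorder = solve-∀

n+n/3+[n∸n/3]≡2*n : ∀ n → n + n / 3 + (n ∸ n / 3) ≡ 2 * n
n+n/3+[n∸n/3]≡2*n n = begin
  n + n / 3 + (n ∸ n / 3)   ≡⟨ +-assoc n (n / 3) (n ∸ n / 3) ⟩
  n + (n / 3 + (n ∸ n / 3)) ≡⟨ cong (n +_) (m+[n∸m]≡n (m/n≤m n 3)) ⟩
  n + n                     ≡⟨ cong (n +_) (+-identityʳ n) ⟨
  2 * n                     ∎
  where open ≡-Reasoning

theorem3 : (k : ℕ) → 2 ≤ k → (inst : Instance) → (choice : List (ℕ × ℕ)) →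
           Feasible k 0 0 inst choice →
           (k + k / 3) * profit choice ≤ 2 * k * argba k inst
theorem3 k _ inst choice =
  Competitive.argba-competitive k (k ∸ k / 3) (k + k / 3) (n+n/3+[n∸n/3]≡2*n k) 2k≤3t 3t≤2+2k
  where
  2k≤3t : 2 * k ≤ 3 * (k ∸ k / 3)
  2k≤3t = ≤-trans (m≤n+m (2 * k) (k % 3)) (≤-reflexive (sym (3*[n∸n/3]≡n%3+2*n k)))
  3t≤2+2k : 3 * (k ∸ k / 3) ≤ 2 + 2 * k
  3t≤2+2k = ≤-trans (≤-reflexive (3*[n∸n/3]≡n%3+2*n k)) (+-monoˡ-≤ (2 * k) (≤-pred (m%n<n k 3)))
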